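{- Let $\lambda$ be a strict partition, $k\ge 1$, and let $R$ be a removable $k$-ribbon of $\lambda$ with head $H(R)$. Then no cell of $R$ lies in a column strictly to the right of the column of $H(R)$. Likewise, no cell of $R$ lies in a row strictly below the row of $H(R)$.
   Context: Conventions. Diagrams are drawn in French convention: a cell is $(c,r)$, column $c$, row $r$, rows numbered from the bottom. A strict partition $\lambda=(\lambda_1>\cdots>\lambda_\ell>0)$ is identified with its shifted diagram $\{(c,r):1\le r\le\ell,\ r\le c\le r+\lambda_r-1\}$. The diagonal value is $\mathrm{diag}(c,r)=c-r+1$, and the main diagonal consists of the cells of value $1$. A subset $R\subseteq\lambda$ is removable if $\lambda\setminus R$ is a shifted diagram. Ribbons. A single ribbon is a nonempty edge-connected skew-shifted diagram (a difference of shifted diagrams) whose cells have pairwise distinct diagonal values. Its head $H(R)$ and tail $T(R)$ are its cells of largest and smallest diagonal value. A double ribbon in $\lambda$ is a union $R\cup S$ of two disjoint single ribbons with $|R|\ge|S|$ such that $T(R)$ lies on the main diagonal of $\lambda$, $T(S)$ lies on the main diagonal of $\lambda\setminus R$, and $R\cup S$ is skew-shifted. Its head is $H(R)$. A $k$-ribbon is a single or double ribbon with $k$ cells in total. -}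

module Defs where

open import Data.Nat using (ℕ; zero; suc; _+_; _∸_; _≤_; _<_; _>_)
open import Data.Product using (Σ; ∃; _×_; _,_; proj₁; proj₂)
open import Data.Sum using (_⊎_)
open import Data.List using (List; []; _∷_; length)
open import Data.List.Membership.Propositional using (_∈_; _∉_)
open import Data.List.Relation.Unary.All using (All)
open import Data.List.Relation.Unary.Linked using (Linked)
open import Data.List.Relation.Unary.Unique.Propositional using (Unique)
open import Relation.Binary.PropositionalEquality using (_≡_)
open import Relation.Nullary using (¬_)
open import Function.Bundles using (_⇔_)

-- Cells (French convention): a cell is (c , r) = (column , row),
-- rows numbered from the bottom starting at 1.

Cell : Set
Cell = ℕ × ℕ

col : Cell → ℕ
col = proj₁

row : Cell → ℕ
row = proj₂

-- diagonal value diag(c,r) = c - r + 1 (all cells we consider have c ≥ r)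
diag : Cell → ℕ
diag (c , r) = suc (c ∸ r)

StrictPartition : List ℕ → Set
StrictPartition la = Linked _>_ la × All (λ x → 0 < x) la

-- 0-indexed part lookup, 0 beyond the length
part : List ℕ → ℕ → ℕ
part []       _       = 0
part (x ∷ xs) zero    = x
part (x ∷ xs) (suc i) = part xs i

InShifted : List ℕ → Cell → Set
InShifted la (c , r) = 1 ≤ r × r ≤ c × c < r + part la (r ∸ 1)

-- Finite sets of cells are represented by duplicate-free lists.

_⊆_ : List Cell → List Cell → Set
A ⊆ B = ∀ {x} → x ∈ A → x ∈ B

SubDiagram : List Cell → List ℕ → Set
SubDiagram A la = ∀ {x} → x ∈ A → InShifted la x

Removable : List ℕ → List Cell → Set
Removable la R =
  SubDiagram R la ×
  Σ (List ℕ) λ mu → StrictPartition mu ×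
    (∀ x → (InShifted la x × x ∉ R) ⇔ InShifted mu x)

SkewShifted : List Cell → Set
SkewShifted A =
  Σ (List ℕ) λ mu → Σ (List ℕ) λ nu →
    StrictPartition mu × StrictPartition nu ×
    (∀ x → InShifted nu x → InShifted mu x) ×
    (∀ x → x ∈ A ⇔ (InShifted mu x × ¬ InShifted nu x))

Adj : Cell → Cell → Set
Adj (c , r) (c' , r') =
  (c ≡ c' × (suc r ≡ r' ⊎ r ≡ suc r')) ⊎
  (r ≡ r' × (suc c ≡ c' ⊎ c ≡ suc c'))

data Path (A : List Cell) : Cell → Cell → Set where
  here : ∀ {x} → x ∈ A → Path A x x
  step : ∀ {x y z} → x ∈ A → Adj x y → Path A y z → Path A x z

EdgeConnected : List Cell → Set
EdgeConnected A = ∀ {x y} → x ∈ A → y ∈ A → Path A x y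

DistinctDiagonals : List Cell → Set
DistinctDiagonals A = ∀ {x y} → x ∈ A → y ∈ A → diag x ≡ diag y → x ≡ y

SingleRibbon : List Cell → Set
SingleRibbon A =
  Unique A × (Σ Cell λ x → x ∈ A) × EdgeConnected A ×
  SkewShifted A × DistinctDiagonals A

IsHead : List Cell → Cell → Set
IsHead A h = h ∈ A × (∀ {x} → x ∈ A → diag x ≤ diag h)

IsTail : List Cell → Cell → Set
IsTail A t = t ∈ A × (∀ {x} → x ∈ A → diag t ≤ diag x)

SingleRibbonIn : List ℕ → List Cell → Cell → Set
SingleRibbonIn la X h = SubDiagram X la × SingleRibbon X × IsHead X h

DoubleRibbonIn : List ℕ → List Cell → Cell → Set
DoubleRibbonIn la X h =
  Σ (List Cell) λ R → Σ (List Cell) λ S →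
    SingleRibbon R × SingleRibbon S ×
    (∀ {x} → x ∈ R → x ∉ S) ×
    length S ≤ length R ×
    SubDiagram R la ×
    (∀ {x} → x ∈ S → InShifted la x × x ∉ R) ×
    (∀ {t} → IsTail R t → InShifted la t × diag t ≡ 1) ×
    (∀ {t} → IsTail S t → (InShifted la t × t ∉ R) × diag t ≡ 1) ×
    Unique X ×
    (∀ x → x ∈ X ⇔ (x ∈ R ⊎ x ∈ S)) ×
    SkewShifted X ×
    IsHead R h

KRibbonIn : List ℕ → ℕ → List Cell → Cell → Set
KRibbonIn la k X h =
  length X ≡ k × (SingleRibbonIn la X h ⊎ DoubleRibbonIn la X h)

-- (1) h has the largest diagonal value in all of X.  For a double ribbon R ∪ S with h = H(R),
--     the cells of R have distinct diagonal values at most diag h, so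
--     |R| ≤ diag h; S is edge-connected and meets diagonal 1, and adjacent
--     cells differ by at most one in diagonal value, so every value
--     1, …, diag x with x ∈ S occurs in S, whence diag x ≤ |S| ≤ |R| ≤ diag h.
--
-- (2) In a removable set, a cell with maximal diagonal value is a corner.
--     Shifted diagrams are down-closed, so a removable X is up-closed inside λ.
--     If x ∈ X lay strictly right of h, then (col x , row h) would lie in λ
--     (below x), hence in X (right of h), yet have a larger diagonal value
--     than h; symmetrically for a cell strictly below h, using (col h , row x).
module Submission where

open import Defs
open import Data.Nat using (ℕ; zero; suc; _+_; _∸_; _≤_; _<_; _>_; z≤n; s≤s; _≟_; _≤?_)
open import Data.Nat.Properties
open import Data.Product using (Σ; _×_; _,_; proj₁; proj₂)
open import Data.Product.Properties using (≡-dec)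
open import Data.Sum using (_⊎_; inj₁; inj₂)
open import Data.Empty using (⊥; ⊥-elim)
open import Data.List using (List; []; _∷_; length; map; upTo)
open import Data.List.Membership.Propositional using (_∈_)
open import Data.List.Membership.Propositional.Properties using (∈-map⁺; ∈-upTo⁺; ∈-upTo⁻)
open import Data.List.Membership.DecPropositional (≡-dec _≟_ _≟_) using (_∈?_)
open import Data.List.Properties using (length-map; length-upTo)
open import Data.List.Relation.Unary.Any using (here; there)
import Data.List.Relation.Unary.All as All
open import Data.List.Relation.Unary.AllPairs using (_∷_)
open import Data.List.Relation.Unary.Linked using (Linked; [-]; _∷_)
open import Data.List.Relation.Unary.Unique.Propositional using (Unique)
open import Data.List.Relation.Unary.Unique.Propositional.Properties using (upTo⁺)
open import Relation.Binary.PropositionalEquality using (_≡_; _≢_; refl; sym; cong; subst; subst₂)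
open import Relation.Nullary using (yes; no)
open import Function.Bundles using (Equivalence)

part-decreasing : ∀ {mu} → Linked _>_ mu → ∀ i →
                  0 < part mu (suc i) → part mu (suc i) < part mu i
part-decreasing {_ ∷ []}    [-]         i       ()
part-decreasing {_ ∷ _ ∷ _} (x>y ∷ _)   zero    _   = x>y
part-decreasing {_ ∷ _ ∷ _} (_   ∷ mu↓) (suc i) pos = part-decreasing mu↓ i pos

-- The last column i + part i of (0-indexed) row i weakly decreases as long as
-- the row is nonempty: rows of a shifted diagram end further left going up.
rowEnd-antitone : ∀ {mu} → Linked _>_ mu → ∀ i j → i ≤ j → 0 < part mu j →
                  j + part mu j ≤ i + part mu i
rowEnd-antitone mu↓ i zero    z≤n _ = ≤-refl
rowEnd-antitone {mu} mu↓ i (suc j) i≤1+j pos with m≤n⇒m<n∨m≡n i≤1+j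
... | inj₂ refl = ≤-refl
... | inj₁ (s≤s i≤j) = ≤-trans stepUp (rowEnd-antitone mu↓ i j i≤j pos′)
  where
  shorter : part mu (suc j) < part mu j
  shorter = part-decreasing mu↓ j pos
  pos′ : 0 < part mu j
  pos′ = <-≤-trans pos (<⇒≤ shorter)
  stepUp : suc j + part mu (suc j) ≤ j + part mu j
  stepUp = subst (_≤ j + part mu j) (+-suc j (part mu (suc j))) (+-monoʳ-≤ j shorter)

row-nonempty : ∀ {r c p} → r ≤ c → c < r + p → 0 < p
row-nonempty {r} {c} {zero}  r≤c c<r = ⊥-elim (<⇒≱ (subst (c <_) (+-identityʳ r) c<r) r≤c)
row-nonempty             {p = suc _} _ _ = s≤s z≤n

shifted-downClosed : ∀ {mu} → Linked _>_ mu → ∀ {c r c′ r′} →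
                     InShifted mu (c , r) → r′ ≤ r → c′ ≤ c → 1 ≤ r′ → r′ ≤ c′ →
                     InShifted mu (c′ , r′)
shifted-downClosed {mu} mu↓ {c} {suc a} {c′} {suc b} (_ , r≤c , c<end) r′≤r c′≤c _ r′≤c′ =
  s≤s z≤n , r′≤c′ ,
  ≤-trans (s≤s c′≤c) (≤-trans c<end (s≤s (rowEnd-antitone mu↓ b a (≤-pred r′≤r) pos)))
  where
  pos : 0 < part mu a
  pos = row-nonempty r≤c c<end

-- If X is removable from λ, then every cell of λ weakly north-east of a cell
-- of X is itself in X: otherwise it would survive in λ ∖ X, and then so
-- would the cell of X below-left of it.
removable-upClosed : ∀ la {X} → Removable la X → ∀ {z y} →
                     z ∈ X → InShifted la y → col z ≤ col y → row z ≤ row y → y ∈ X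
removable-upClosed _ {X} (X⊆λ , mu , (mu↓ , _) , λ∖X≡μ) {z} {y} z∈X y∈λ cz≤cy rz≤ry
  with y ∈? X
... | yes y∈X = y∈X
... | no  y∉X = ⊥-elim (proj₂ (Equivalence.from (λ∖X≡μ z) z∈μ) z∈X)
  where
  y∈μ : InShifted mu y
  y∈μ = Equivalence.to (λ∖X≡μ y) (y∈λ , y∉X)
  z∈μ : InShifted mu z
  z∈μ with X⊆λ z∈X
  ... | 1≤rz , rz≤cz , _ = shifted-downClosed mu↓ y∈μ rz≤ry cz≤cy 1≤rz rz≤cz

diag-≤⇒ : ∀ {c r c′ r′} → r ≤ c → r′ ≤ c′ →
          diag (c , r) ≤ diag (c′ , r′) → c + r′ ≤ c′ + r
diag-≤⇒ {c} {r} {c′} {r′} r≤c r′≤c′ (s≤s le) = begin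
  c + r′                ≡⟨ cong (_+ r′) (sym (m∸n+n≡m r≤c)) ⟩
  (c ∸ r) + r + r′      ≡⟨ +-assoc (c ∸ r) r r′ ⟩
  (c ∸ r) + (r + r′)    ≤⟨ +-monoˡ-≤ (r + r′) le ⟩
  (c′ ∸ r′) + (r + r′)  ≡⟨ cong ((c′ ∸ r′) +_) (+-comm r r′) ⟩
  (c′ ∸ r′) + (r′ + r)  ≡⟨ sym (+-assoc (c′ ∸ r′) r′ r) ⟩
  (c′ ∸ r′) + r′ + r    ≡⟨ cong (_+ r) (m∸n+n≡m r′≤c′) ⟩
  c′ + r                ∎
  where open ≤-Reasoning

∸-sucˡ-≤ : ∀ m n → suc m ∸ n ≤ suc (m ∸ n)
∸-sucˡ-≤ m       zero    = ≤-refl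
∸-sucˡ-≤ zero    (suc n) = subst (_≤ 1) (sym (0∸n≡0 n)) z≤n
∸-sucˡ-≤ (suc m) (suc n) = ∸-sucˡ-≤ m n

∸-predʳ-≤ : ∀ m n → m ∸ n ≤ suc (m ∸ suc n)
∸-predʳ-≤ zero    zero    = z≤n
∸-predʳ-≤ (suc m) zero    = ≤-refl
∸-predʳ-≤ zero    (suc n) = z≤n
∸-predʳ-≤ (suc m) (suc n) = ∸-predʳ-≤ m n

adj-diag≤ : ∀ {a b} → Adj a b → diag b ≤ suc (diag a)
adj-diag≤ {c , r}     (inj₁ (refl , inj₁ refl)) = s≤s (≤-trans (∸-monoʳ-≤ c (n≤1+n r)) (n≤1+n _))
adj-diag≤ {c , suc r} (inj₁ (refl , inj₂ refl)) = s≤s (∸-predʳ-≤ c r)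
adj-diag≤ {c , r}     (inj₂ (refl , inj₁ refl)) = s≤s (∸-sucˡ-≤ c r)
adj-diag≤ {suc c , r} (inj₂ (refl , inj₂ refl)) = s≤s (≤-trans (∸-monoˡ-≤ r (n≤1+n c)) (n≤1+n _))

path-meetsDiagonal : ∀ {S a b} → Path S a b → ∀ v → diag a ≤ v → v ≤ diag b →
                     Σ Cell λ y → y ∈ S × diag y ≡ v
path-meetsDiagonal (here a∈S) v a≤v v≤b = _ , a∈S , ≤-antisym a≤v v≤b
path-meetsDiagonal {a = a} (step a∈S a~a′ a′⇝b) v a≤v v≤b with diag a ≟ v
... | yes a≡v = a , a∈S , a≡v
... | no  a≢v = path-meetsDiagonal a′⇝b v (≤-trans (adj-diag≤ a~a′) (≤∧≢⇒< a≤v a≢v)) v≤b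

tail-exists : (A : List Cell) → Σ Cell (_∈ A) → Σ Cell (IsTail A)
tail-exists (a ∷ A) _ = least a A
  where
  least : (a : Cell) (A : List Cell) → Σ Cell (IsTail (a ∷ A))
  least a [] = a , here refl , λ { (here refl) → ≤-refl }
  least a (b ∷ B) with least b B
  ... | t , t∈ , t-min with diag a ≤? diag t
  ...   | yes a≤t = a , here refl , λ { (here refl) → ≤-refl ; (there x∈) → ≤-trans a≤t (t-min x∈) }
  ...   | no  a≰t = t , there t∈ , λ { (here refl) → <⇒≤ (≰⇒> a≰t) ; (there x∈) → t-min x∈ }

delete : ∀ {A : Set} {x : A} (ys : List A) → x ∈ ys → List A
delete (_ ∷ ys) (here _)  = ys
delete (y ∷ ys) (there p) = y ∷ delete ys p

length-delete : ∀ {A : Set} {x : A} (ys : List A) (p : x ∈ ys) →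
                suc (length (delete ys p)) ≡ length ys
length-delete (_ ∷ _)  (here _)  = refl
length-delete (_ ∷ ys) (there p) = cong suc (length-delete ys p)

∈-delete : ∀ {A : Set} {x z : A} (ys : List A) (p : x ∈ ys) → z ∈ ys → z ≢ x → z ∈ delete ys p
∈-delete (_ ∷ _)  (here refl) (here refl) z≢x = ⊥-elim (z≢x refl)
∈-delete (_ ∷ _)  (here refl) (there q)   _   = q
∈-delete (_ ∷ _)  (there p)   (here refl) _   = here refl
∈-delete (_ ∷ ys) (there p)   (there q)   z≢x = there (∈-delete ys p q z≢x)

length-≤-byInjection : ∀ {A B : Set} (f : A → B) (xs : List A) (ys : List B) → Unique xs →
                       (∀ {a b} → a ∈ xs → b ∈ xs → f a ≡ f b → a ≡ b) →
                       (∀ {a} → a ∈ xs → f a ∈ ys) → length xs ≤ length ys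
length-≤-byInjection f []       ys _           _   _  = z≤n
length-≤-byInjection f (x ∷ xs) ys (x∉xs ∷ xs!) inj into =
  subst (suc (length xs) ≤_) (length-delete ys fx∈ys)
    (s≤s (length-≤-byInjection f xs (delete ys fx∈ys) xs!
            (λ a∈ b∈ → inj (there a∈) (there b∈)) into′))
  where
  fx∈ys : f x ∈ ys
  fx∈ys = into (here refl)
  into′ : ∀ {a} → a ∈ xs → f a ∈ delete ys fx∈ys
  into′ a∈xs = ∈-delete ys fx∈ys (into (there a∈xs))
                 (λ fa≡fx → All.lookup x∉xs a∈xs (inj (here refl) (there a∈xs) (sym fa≡fx)))

distinctDiagonals-length≤ : ∀ {R h} → Unique R → DistinctDiagonals R → IsHead R h →
                            length R ≤ diag h
distinctDiagonals-length≤ {R} {h} R! distinct (_ , h-max) =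
  subst (length R ≤_) (length-upTo (diag h))
    (length-≤-byInjection (λ x → col x ∸ row x) R (upTo (diag h)) R!
      (λ a∈ b∈ e → distinct a∈ b∈ (cong suc e)) (λ a∈ → ∈-upTo⁺ (h-max a∈)))

-- An edge-connected set of cells meeting the main diagonal contains a cell
-- of every diagonal value up to diag x for each of its cells x, so it has
-- at least diag x cells.
connected-diag≤length : ∀ {S t x} → EdgeConnected S → t ∈ S → diag t ≡ 1 → x ∈ S →
                        diag x ≤ length S
connected-diag≤length {S} {t} {x} connected t∈S t-on-diag x∈S =
  subst₂ _≤_ (length-upTo (diag x)) (length-map diag S)
    (length-≤-byInjection suc (upTo (diag x)) (map diag S) (upTo⁺ _)
      (λ _ _ → suc-injective) (λ v∈ → valueOccurs _ (∈-upTo⁻ v∈)))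
  where
  valueOccurs : ∀ v → v < diag x → suc v ∈ map diag S
  valueOccurs v v<x
    with path-meetsDiagonal (connected t∈S x∈S) (suc v) (subst (_≤ suc v) (sym t-on-diag) (s≤s z≤n)) v<x
  ... | y , y∈S , y-on-v = subst (_∈ map diag S) y-on-v (∈-map⁺ diag y∈S)

kRibbon-headMaximal : ∀ {la k X h} → KRibbonIn la k X h → IsHead X h
kRibbon-headMaximal (_ , inj₁ (_ , _ , head)) = head
kRibbon-headMaximal {h = h}
  (_ , inj₂ (R , S , (R! , _ , _ , _ , R-distinct) , (_ , S-nonempty , S-connected , _ , _) ,
             _ , |S|≤|R| , _ , _ , _ , S-tail-on-diag , _ , X≡R∪S , _ , R-head@(h∈R , h-maxR))) =
  Equivalence.from (X≡R∪S h) (inj₁ h∈R) , λ {x} x∈X → below (Equivalence.to (X≡R∪S x) x∈X)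
  where
  tailS : Σ Cell (IsTail S)
  tailS = tail-exists S S-nonempty
  tailS-on-diag : diag (proj₁ tailS) ≡ 1
  tailS-on-diag = proj₂ (S-tail-on-diag (proj₂ tailS))
  below : ∀ {x} → x ∈ R ⊎ x ∈ S → diag x ≤ diag h
  below (inj₁ x∈R) = h-maxR x∈R
  below {x} (inj₂ x∈S) = begin
    diag x   ≤⟨ connected-diag≤length S-connected (proj₁ (proj₂ tailS)) tailS-on-diag x∈S ⟩
    length S ≤⟨ |S|≤|R| ⟩
    length R ≤⟨ distinctDiagonals-length≤ R! R-distinct R-head ⟩
    diag h   ∎
    where open ≤-Reasoning

-- A cell
-- x ∈ X strictly right of h would force (col x , row h) ∈ X, and one strictly
-- below h would force (col h , row x) ∈ X; both exceed h in diagonal value.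
removable-headCorner : ∀ la {X h} → StrictPartition la → Removable la X → IsHead X h →
                       ∀ {x} → x ∈ X → col x ≤ col h × row h ≤ row x
removable-headCorner la {X} {ch , rh} (λ↓ , _) removable (h∈X , h-max) {cx , rx} x∈X =
  ≮⇒≥ rightOfHead , ≮⇒≥ belowHead
  where
  h∈λ : InShifted la (ch , rh)
  h∈λ = proj₁ removable h∈X
  x∈λ : InShifted la (cx , rx)
  x∈λ = proj₁ removable x∈X
  rh≤ch : rh ≤ ch
  rh≤ch = proj₁ (proj₂ h∈λ)
  rx≤cx : rx ≤ cx
  rx≤cx = proj₁ (proj₂ x∈λ)
  x-dominated : cx + rh ≤ ch + rx
  x-dominated = diag-≤⇒ rx≤cx rh≤ch (h-max x∈X)

  rightOfHead : ch < cx → ⊥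
  rightOfHead ch<cx = <⇒≱ ch<cx (+-cancelʳ-≤ rh cx ch (diag-≤⇒ rh≤cx rh≤ch (h-max y∈X)))
    where
    rh<rx : rh < rx
    rh<rx = +-cancelˡ-< ch rh rx (<-≤-trans (+-monoˡ-< rh ch<cx) x-dominated)
    rh≤cx : rh ≤ cx
    rh≤cx = ≤-trans rh≤ch (<⇒≤ ch<cx)
    y∈X : (cx , rh) ∈ X
    y∈X = removable-upClosed la removable h∈X
            (shifted-downClosed λ↓ x∈λ (<⇒≤ rh<rx) ≤-refl (proj₁ h∈λ) rh≤cx)
            (<⇒≤ ch<cx) ≤-refl

  belowHead : rx < rh → ⊥
  belowHead rx<rh = <⇒≱ rx<rh (+-cancelˡ-≤ ch rh rx (diag-≤⇒ rx≤ch rh≤ch (h-max y∈X)))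
    where
    cx<ch : cx < ch
    cx<ch = +-cancelʳ-< rh cx ch (≤-<-trans x-dominated (+-monoʳ-< ch rx<rh))
    rx≤ch : rx ≤ ch
    rx≤ch = ≤-trans rx≤cx (<⇒≤ cx<ch)
    y∈X : (ch , rx) ∈ X
    y∈X = removable-upClosed la removable x∈X
            (shifted-downClosed λ↓ h∈λ (<⇒≤ rx<rh) ≤-refl (proj₁ x∈λ) rx≤ch)
            (<⇒≤ cx<ch) ≤-refl

mainTheorem7 : (la : List ℕ) → StrictPartition la → (k : ℕ) → 1 ≤ k →
    (X : List Cell) → (h : Cell) → KRibbonIn la k X h → Removable la X →
    ∀ {x} → x ∈ X → col x ≤ col h × row h ≤ row x
mainTheorem7 la strict _ _ _ _ ribbon removable =
  removable-headCorner la strict removable (kRibbon-headMaximal {la} ribbon)
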